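{- For every even integer $n\geq 14$ there exists a connected, asymmetric, $3$-regular, non-bipartite, and triangle-free graph on $n$ vertices.
   Context: Graphs are finite, simple and undirected. A graph is asymmetric if its only automorphism is the identity. -}

module Defs where

open import Data.Nat using (ℕ; suc)
open import Data.Bool using (Bool; true; false)
open import Data.Fin using (Fin)
open import Data.List using (allFin; length; filterᵇ)
open import Data.Product using (Σ; _×_; ∃)
open import Relation.Binary.PropositionalEquality using (_≡_; _≢_)
open import Relation.Nullary using (¬_)
open import Data.Empty using (⊥)
open import Data.Fin.Permutation using (Permutation′; _⟨$⟩ʳ_)

record Graph (n : ℕ) : Set where
  field
    adj      : Fin n → Fin n → Bool
    symmetric : ∀ u v → adj u v ≡ adj v u
    loopless  : ∀ v → adj v v ≡ false
open Graph public

degree : ∀ {n} → Graph n → Fin n → ℕ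
degree G v = length (filterᵇ (adj G v) (allFin _))

Regular : ∀ {n} → ℕ → Graph n → Set
Regular k G = ∀ v → degree G v ≡ k

data Walk {n : ℕ} (G : Graph n) : Fin n → Fin n → Set where
  here : ∀ {u} → Walk G u u
  step : ∀ {u w v} → adj G u w ≡ true → Walk G w v → Walk G u v

Connected : ∀ {n} → Graph n → Set
Connected G = ∀ u v → Walk G u v

IsAutomorphism : ∀ {n} → Graph n → Permutation′ n → Set
IsAutomorphism G σ = ∀ u v → adj G (σ ⟨$⟩ʳ u) (σ ⟨$⟩ʳ v) ≡ adj G u v

Asymmetric : ∀ {n} → Graph n → Set
Asymmetric G = ∀ σ → IsAutomorphism G σ → ∀ v → σ ⟨$⟩ʳ v ≡ v

Bipartite : ∀ {n} → Graph n → Set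
Bipartite {n} G = Σ (Fin n → Bool) λ c → ∀ u v → adj G u v ≡ true → c u ≢ c v

TriangleFree : ∀ {n} → Graph n → Set
TriangleFree G = ∀ u v w → adj G u v ≡ true → adj G v w ≡ true → adj G u w ≡ true → ⊥

{-# OPTIONS --safe #-}
module Submission where

-- The graph on 2(n + 7) vertices consists of a core c0, ..., c9 and a ladder with n + 2 rungs: one rail
-- runs from c3 to c6, the other from c5 to c7, and these four core vertices have only two core neighbours.
-- It is cubic and contains the 5-cycle c0 c1 c3 c4 c7; it is triangle-free because the ladder is
-- bipartite and no core vertex has two adjacent neighbours.
-- Asymmetry: every vertex except c0 and c7 lies on a 4-cycle, and c0 lies on three 5-cycles while c7
-- lies on two, so every automorphism fixes c0 and hence preserves the numbers of walks to c0. These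
-- numbers, for walks of length below 5, separate the three neighbours of every core vertex, so the
-- whole core is fixed. Along the rails, a fixed vertex whose other two neighbours are fixed fixes the
-- third one as well.

open import Defs
open import Data.Nat using (ℕ; _≤_; _*_)
open import Data.Product using (Σ; _×_)
open import Relation.Nullary using (¬_)

open import Data.Bool using (Bool; true; false; not; _xor_; if_then_else_; T)
import Data.Bool.Properties as Bool
open import Data.Bool.Properties using (not-involutive; not-¬; ¬-not; not-distribˡ-xor; xor-same; T-≡)
open import Data.Empty using (⊥; ⊥-elim)
open import Data.Fin using (Fin; zero; suc; toℕ; fromℕ<)
import Data.Fin.Properties as Fin
open import Data.Fin.Permutation using (_⟨$⟩ʳ_)
open import Data.List using (List; []; _∷_; map; length; filterᵇ; allFin; upTo)
import Data.List.Properties as List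
open import Data.List.Properties using (map-∘; map-cong; length-map)
open import Data.List.Membership.Propositional using (_∈_; _∉_; find; lose)
open import Data.List.Membership.Propositional.Properties
  using (∈-map⁺; ∈-map⁻; ∈-filter⁺; ∈-filter⁻; ∈-allFin; ∈-AllPairs₂)
open import Data.List.Membership.Propositional.Properties.WithK using (unique∧set⇒bag)
open import Data.List.Relation.Binary.BagAndSetEquality using (∼bag⇒↭)
open import Data.List.Relation.Binary.Permutation.Propositional using (_↭_; ↭-sym)
import Data.List.Relation.Binary.Permutation.Propositional.Properties as ↭
open import Data.List.Relation.Unary.All as All using (All; all?; _∷_; [])
open import Data.List.Relation.Unary.AllPairs using (AllPairs; _∷_; []; allPairs?)
import Data.List.Relation.Unary.AllPairs.Properties as AllPairs
open import Data.List.Relation.Unary.Any using (Any; here; there; any?)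
open import Data.List.Relation.Unary.Unique.Propositional using (Unique)
import Data.List.Relation.Unary.Unique.Propositional.Properties as Unique
import Data.List.Relation.Unary.Unique.DecPropositional as DecUnique
open import Data.Nat using (zero; suc; _+_; _∸_; s≤s; s≤s⁻¹)
import Data.Nat.Properties as ℕ
open import Data.Nat.GeneralisedArithmetic using (fold)
open import Data.Nat.ListAction using (sum)
open import Data.Nat.ListAction.Properties using (sum-↭)
open import Data.Product using (_,_; proj₁; proj₂)
open import Data.Product.Function.NonDependent.Propositional using (_×-↔_)
open import Data.Sum using (_⊎_; inj₁; inj₂)
open import Data.Sum.Function.Propositional using (_⊎-↔_)
open import Function using (_∘_; _↔_; _⇔_; Inverse; Injection; Equivalence; mk⇔; mk↔ₛ′)
open import Function.Properties.Inverse using (↔-refl; ↔-sym; ↔-trans; ↔⇒↣)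
open import Function.Related.Propositional using (module EquationalReasoning)
open import Relation.Binary.Definitions using (DecidableEquality)
open import Relation.Binary.PropositionalEquality
open import Relation.Nullary using (Dec; yes; no; does; ¬?; _×-dec_; _⊎-dec_)
open import Relation.Nullary.Decidable using (map′; T?; from-yes; does-⇔; dec-true; dec-false)

does≡true⇒ : ∀ {A : Set} (a? : Dec A) → does a? ≡ true → A
does≡true⇒ (yes a) _ = a
does≡true⇒ (no _)  ()

module _ {n : ℕ} {G : Graph n} where

  infixr 5 _◅◅_
  _◅◅_ : ∀ {u v w} → Walk G u v → Walk G v w → Walk G u w
  here ◅◅ q = q
  step e p ◅◅ q = step e (p ◅◅ q)

  reverse : ∀ {u v} → Walk G u v → Walk G v u
  reverse here = here
  reverse (step {u} {w} e p) = reverse p ◅◅ step (trans (symmetric G w u) e) here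

  rooted⇒connected : (r : Fin n) → (∀ u → Walk G u r) → Connected G
  rooted⇒connected r to-r u v = to-r u ◅◅ reverse (to-r v)

  odd-length : ∀ {u v} → Walk G u v → Bool
  odd-length here       = false
  odd-length (step _ p) = not (odd-length p)

  colour-parity : (c : Fin n → Bool) → (∀ u v → adj G u v ≡ true → c u ≢ c v) →
                  ∀ {u v} (p : Walk G u v) → c u xor c v ≡ odd-length p
  colour-parity c proper (here {u}) = xor-same (c u)
  colour-parity c proper (step {u} {w} {v} e p) = begin
    c u xor c v        ≡⟨ cong (_xor c v) (¬-not (proper u w e)) ⟩
    not (c w) xor c v  ≡⟨ not-distribˡ-xor (c w) (c v) ⟨
    not (c w xor c v)  ≡⟨ cong not (colour-parity c proper p) ⟩
    not (odd-length p) ∎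
    where open ≡-Reasoning

  odd-closed-walk⇒¬bipartite : ∀ {u} (p : Walk G u u) → odd-length p ≡ true → ¬ Bipartite G
  odd-closed-walk⇒¬bipartite {u} p odd-p (c , proper)
    with () ← trans (sym (xor-same (c u))) (trans (colour-parity c proper p) odd-p)

module NeighbourLists {V : Set} (_≟_ : DecidableEquality V) (nb : V → List V) where

  open import Data.List.Membership.DecPropositional _≟_ using (_∈?_)

  walks : ℕ → V → V → ℕ
  walks zero    x y = if does (x ≟ y) then 1 else 0
  walks (suc L) x y = sum (map (λ z → walks L z y) (nb x))

  profile : ℕ → V → V → List ℕ
  profile K f x = map (λ L → walks L x f) (upTo K)

  -- x y₁ y₂ y₃ x is a closed walk without backtracking: a 4-cycle through x when there are no triangles.
  record Square (x : V) : Set where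
    constructor square
    field
      {y₁ y₂ y₃} : V
      x~y₁  : y₁ ∈ nb x
      y₁~y₂ : y₂ ∈ nb y₁
      y₂~y₃ : y₃ ∈ nb y₂
      y₃~x  : x ∈ nb y₃
      y₂≢x  : y₂ ≢ x
      y₃≢y₁ : y₃ ≢ y₁

  square? : ∀ x → Dec (Square x)
  square? x = map′ from-any to-any
    (any? (λ y₁ → any? (λ y₂ → ¬? (y₂ ≟ x) ×-dec
                                 any? (λ y₃ → ¬? (y₃ ≟ y₁) ×-dec x ∈? nb y₃) (nb y₂)) (nb y₁)) (nb x))
    where
    AnySquare : Set
    AnySquare = Any (λ y₁ → Any (λ y₂ → y₂ ≢ x × Any (λ y₃ → y₃ ≢ y₁ × x ∈ nb y₃) (nb y₂)) (nb y₁)) (nb x)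
    from-any : AnySquare → Square x
    from-any a = let _ , m₁ , b = find a ; _ , m₂ , ne₂ , c = find b ; _ , m₃ , ne₃ , m₄ = find c
                 in square m₁ m₂ m₃ m₄ ne₂ ne₃
    to-any : Square x → AnySquare
    to-any (square m₁ m₂ m₃ m₄ ne₂ ne₃) = lose m₁ (lose m₂ (ne₂ , lose m₃ (ne₃ , m₄)))

  ∈-nb-subst : ∀ {x x′ y y′} → x ≡ x′ → y ≡ y′ → y ∈ nb x → y′ ∈ nb x′
  ∈-nb-subst refl refl y∈ = y∈

  PreservesAdjacency : V ↔ V → Set
  PreservesAdjacency aut = ∀ {x y} → y ∈ nb x ⇔ Inverse.to aut y ∈ nb (Inverse.to aut x)

  module Automorphism (nb-unique : ∀ x → Unique (nb x)) (aut : V ↔ V) (aut-nb : PreservesAdjacency aut) where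

    open Inverse aut public using ()
      renaming (to to τ; from to τ⁻¹; strictlyInverseˡ to τ∘τ⁻¹; strictlyInverseʳ to τ⁻¹∘τ)

    τ-injective : ∀ {x y} → τ x ≡ τ y → x ≡ y
    τ-injective = Injection.injective (↔⇒↣ aut)

    τ⁻¹-injective : ∀ {x y} → τ⁻¹ x ≡ τ⁻¹ y → x ≡ y
    τ⁻¹-injective = Injection.injective (↔⇒↣ (↔-sym aut))

    τ-preserves : ∀ {x y} → y ∈ nb x → τ y ∈ nb (τ x)
    τ-preserves = Equivalence.to aut-nb

    τ⁻¹-preserves : ∀ {x y} → y ∈ nb x → τ⁻¹ y ∈ nb (τ⁻¹ x)
    τ⁻¹-preserves {x} {y} y∈ = Equivalence.from aut-nb (∈-nb-subst (sym (τ∘τ⁻¹ x)) (sym (τ∘τ⁻¹ y)) y∈)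

    nb-image : ∀ x → map τ (nb x) ↭ nb (τ x)
    nb-image x =
      ∼bag⇒↭ (unique∧set⇒bag (Unique.map⁺ τ-injective (nb-unique x)) (nb-unique (τ x)) (mk⇔ into onto))
      where
      into : ∀ {z} → z ∈ map τ (nb x) → z ∈ nb (τ x)
      into z∈ with _ , y∈ , refl ← ∈-map⁻ τ z∈ = τ-preserves y∈
      onto : ∀ {z} → z ∈ nb (τ x) → z ∈ map τ (nb x)
      onto {z} z∈ = subst (_∈ map τ (nb x)) (τ∘τ⁻¹ z) (∈-map⁺ τ (∈-nb-subst (τ⁻¹∘τ x) refl (τ⁻¹-preserves z∈)))

    walks-invariant : ∀ L x y → walks L (τ x) (τ y) ≡ walks L x y
    walks-invariant zero x y = cong (if_then 1 else 0) (does-⇔ (mk⇔ τ-injective (cong τ)) (τ x ≟ τ y) (x ≟ y))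
    walks-invariant (suc L) x y = begin
      sum (map (λ z → walks L z (τ y)) (nb (τ x)))      ≡⟨ sum-↭ (↭.map⁺ _ (↭-sym (nb-image x))) ⟩
      sum (map (λ z → walks L z (τ y)) (map τ (nb x)))  ≡⟨ cong sum (map-∘ (nb x)) ⟨
      sum (map (λ z → walks L (τ z) (τ y)) (nb x))      ≡⟨ cong sum (map-cong (λ z → walks-invariant L z y) (nb x)) ⟩
      sum (map (λ z → walks L z y) (nb x))              ∎
      where open ≡-Reasoning

    profile-invariant : ∀ K {f} → τ f ≡ f → ∀ x → profile K f (τ x) ≡ profile K f x
    profile-invariant K {f} τf≡f x =
      map-cong (λ L → trans (cong (walks L (τ x)) (sym τf≡f)) (walks-invariant L x f)) (upTo K)

    square-preimage : ∀ {x} → Square (τ x) → Square x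
    square-preimage {x} (square m₁ m₂ m₃ m₄ ne₂ ne₃) = subst Square (τ⁻¹∘τ x)
      (square (τ⁻¹-preserves m₁) (τ⁻¹-preserves m₂) (τ⁻¹-preserves m₃) (τ⁻¹-preserves m₄)
              (ne₂ ∘ τ⁻¹-injective) (ne₃ ∘ τ⁻¹-injective))

    fixed-neighbour : ∀ {z y} → τ z ≡ z → y ∈ nb z → τ y ∈ nb z
    fixed-neighbour τz≡z y∈ = subst (λ a → _ ∈ nb a) τz≡z (τ-preserves y∈)

    fixes-separated-neighbours : ∀ {A : Set} (s : V → A) → (∀ x → s (τ x) ≡ s x) →
                                 ∀ {z} → τ z ≡ z → Unique (map s (nb z)) → ∀ {y} → y ∈ nb z → τ y ≡ y
    fixes-separated-neighbours s s-invariant τz≡z separated {y} y∈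
      with ∈-AllPairs₂ (AllPairs.map⁻ separated) (fixed-neighbour τz≡z y∈) y∈
    ... | inj₁ fixed        = fixed
    ... | inj₂ (inj₁ s≢)    = ⊥-elim (s≢ (s-invariant y))
    ... | inj₂ (inj₂ s≢)    = ⊥-elim (s≢ (sym (s-invariant y)))

    fixes-last-neighbour : ∀ {z y} → τ z ≡ z → y ∈ nb z →
                           (∀ {w} → w ∈ nb z → w ≢ y → τ w ≡ w) → τ y ≡ y
    fixes-last-neighbour {y = y} τz≡z y∈ others with τ y ≟ y
    ... | yes fixed = fixed
    ... | no moved = ⊥-elim (moved (τ-injective (others (fixed-neighbour τz≡z y∈) moved)))

  module Relabelling {N : ℕ} (ι : V ↔ Fin N)
                     (nb-sym : ∀ {x y} → y ∈ nb x → x ∈ nb y) (nb-irrefl : ∀ x → x ∉ nb x) where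

    open Inverse ι public using ()
      renaming (to to ⟦_⟧; from to vertex; strictlyInverseˡ to ⟦vertex⟧; strictlyInverseʳ to vertex⟦⟧)

    graph : Graph N
    graph = record
      { adj       = λ i j → does (vertex j ∈? nb (vertex i))
      ; symmetric = λ i j → does-⇔ (mk⇔ nb-sym nb-sym) (vertex j ∈? nb (vertex i)) (vertex i ∈? nb (vertex j))
      ; loopless  = λ i → dec-false (vertex i ∈? nb (vertex i)) (nb-irrefl (vertex i))
      }

    adj⇒∈nb : ∀ {i j} → adj graph i j ≡ true → vertex j ∈ nb (vertex i)
    adj⇒∈nb {i} {j} = does≡true⇒ (vertex j ∈? nb (vertex i))

    ∈nb⇒adj : ∀ {i j} → vertex j ∈ nb (vertex i) → adj graph i j ≡ true
    ∈nb⇒adj {i} {j} = dec-true (vertex j ∈? nb (vertex i))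

    edge : ∀ {x y} → y ∈ nb x → adj graph ⟦ x ⟧ ⟦ y ⟧ ≡ true
    edge {x} {y} y∈ = ∈nb⇒adj (∈-nb-subst (sym (vertex⟦⟧ x)) (sym (vertex⟦⟧ y)) y∈)

    hop : ∀ {x y t} → y ∈ nb x → Walk graph ⟦ y ⟧ t → Walk graph ⟦ x ⟧ t
    hop y∈ = step (edge y∈)

    connected : (r : V) → (∀ x → Walk graph ⟦ x ⟧ ⟦ r ⟧) → Connected graph
    connected r to-r =
      rooted⇒connected ⟦ r ⟧ λ i → subst (λ k → Walk graph k ⟦ r ⟧) (⟦vertex⟧ i) (to-r (vertex i))

    regular : ∀ {d} → (∀ x → Unique (nb x)) → (∀ x → length (nb x) ≡ d) → Regular d graph
    regular {d} nb-unique nb-length i = begin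
      degree graph i                    ≡⟨ ↭.↭-length neighbours ⟩
      length (map ⟦_⟧ (nb (vertex i)))  ≡⟨ length-map ⟦_⟧ (nb (vertex i)) ⟩
      length (nb (vertex i))            ≡⟨ nb-length (vertex i) ⟩
      d                                 ∎
      where
      open ≡-Reasoning
      adj? : ∀ j → Dec (T (adj graph i j))
      adj? = T? ∘ adj graph i
      into : ∀ {j} → j ∈ filterᵇ (adj graph i) (allFin N) → j ∈ map ⟦_⟧ (nb (vertex i))
      into {j} j∈ = subst (_∈ map ⟦_⟧ _) (⟦vertex⟧ j)
        (∈-map⁺ ⟦_⟧ (adj⇒∈nb (Equivalence.to T-≡ (proj₂ (∈-filter⁻ adj? {xs = allFin N} j∈)))))
      onto : ∀ {j} → j ∈ map ⟦_⟧ (nb (vertex i)) → j ∈ filterᵇ (adj graph i) (allFin N)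
      onto j∈ with y , y∈ , refl ← ∈-map⁻ ⟦_⟧ j∈ =
        ∈-filter⁺ adj? (∈-allFin _) (Equivalence.from T-≡ (∈nb⇒adj (∈-nb-subst refl (sym (vertex⟦⟧ y)) y∈)))
      neighbours : filterᵇ (adj graph i) (allFin N) ↭ map ⟦_⟧ (nb (vertex i))
      neighbours = ∼bag⇒↭ (unique∧set⇒bag (Unique.filter⁺ adj? (Unique.allFin⁺ N))
        (Unique.map⁺ (Injection.injective (↔⇒↣ ι)) (nb-unique (vertex i))) (mk⇔ into onto))

    triangle-free : (∀ {x y z} → y ∈ nb x → z ∈ nb y → x ∈ nb z → ⊥) → TriangleFree graph
    triangle-free no-triangle u v w uv vw uw =
      no-triangle (adj⇒∈nb uv) (adj⇒∈nb vw) (nb-sym (adj⇒∈nb uw))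

    asymmetric : (∀ aut → PreservesAdjacency aut → ∀ x → Inverse.to aut x ≡ x) → Asymmetric graph
    asymmetric rigid σ σ-adj i = begin
      σ ⟨$⟩ʳ i                    ≡⟨ ⟦vertex⟧ _ ⟨
      ⟦ vertex (σ ⟨$⟩ʳ i) ⟧        ≡⟨ cong (λ k → ⟦ vertex (σ ⟨$⟩ʳ k) ⟧) (⟦vertex⟧ i) ⟨
      ⟦ Inverse.to τ (vertex i) ⟧  ≡⟨ cong ⟦_⟧ (rigid τ τ-nb (vertex i)) ⟩
      ⟦ vertex i ⟧                ≡⟨ ⟦vertex⟧ i ⟩
      i                           ∎
      where
      open ≡-Reasoning
      τ : V ↔ V
      τ = ↔-trans ι (↔-trans σ (↔-sym ι))
      τ-nb : PreservesAdjacency τ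
      τ-nb {x} {y} = mk⇔
        (λ y∈ → adj⇒∈nb (trans (σ-adj ⟦ x ⟧ ⟦ y ⟧) (edge y∈)))
        (λ τy∈ → ∈-nb-subst (vertex⟦⟧ x) (vertex⟦⟧ y) (adj⇒∈nb (trans (sym (σ-adj ⟦ x ⟧ ⟦ y ⟧)) (∈nb⇒adj τy∈))))

module Construction (n : ℕ) where

  -- rail b i j has i rail vertices between it and core α b, and j between it and core β b; recording
  -- both distances lets evaluation recognise either end of a rail.
  data Vertex : Set where
    core : Fin 10 → Vertex
    rail : (b : Bool) (i j : ℕ) → i + j ≡ suc n → Vertex

  pattern c0 = zero
  pattern c1 = suc c0
  pattern c2 = suc c1
  pattern c3 = suc c2
  pattern c4 = suc c3
  pattern c5 = suc c4
  pattern c6 = suc c5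
  pattern c7 = suc c6
  pattern c8 = suc c7
  pattern c9 = suc c8

  rail-≡ : ∀ {b b′ i i′ j j′ p p′} → b ≡ b′ → i ≡ i′ → rail b i j p ≡ rail b′ i′ j′ p′
  rail-≡ {i = i} {j = j} {j′ = j′} {p} {p′} refl refl
    with refl ← ℕ.+-cancelˡ-≡ i j j′ (trans p (sym p′)) = cong (rail _ i j) (ℕ.≡-irrelevant p p′)

  rail-injective : ∀ {b b′ i i′ j j′ p p′} → rail b i j p ≡ rail b′ i′ j′ p′ → b ≡ b′ × i ≡ i′
  rail-injective refl = refl , refl

  opposite-rails-differ : ∀ {b i j p i′ j′ p′} → rail (not b) i j p ≢ rail b i′ j′ p′
  opposite-rails-differ e = not-¬ refl (sym (proj₁ (rail-injective e)))

  _≟_ : DecidableEquality Vertex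
  core c ≟ core d = map′ (cong core) (λ { refl → refl }) (c Fin.≟ d)
  core _ ≟ rail _ _ _ _ = no λ ()
  rail _ _ _ _ ≟ core _ = no λ ()
  rail b i _ _ ≟ rail b′ i′ _ _ =
    map′ (λ (b≡b′ , i≡i′) → rail-≡ b≡b′ i≡i′) rail-injective ((b Bool.≟ b′) ×-dec (i ℕ.≟ i′))

  start end : Bool → Vertex
  start b = rail b 0 (suc n) refl
  end b = rail b (suc n) 0 (ℕ.+-identityʳ (suc n))

  α β : Bool → Fin 10
  α false = c3
  α true = c5
  β false = c6
  β true = c7

  core-nb : Fin 10 → List Vertex
  core-nb c0 = core c1 ∷ core c2 ∷ core c7 ∷ []
  core-nb c1 = core c0 ∷ core c3 ∷ core c8 ∷ []
  core-nb c2 = core c0 ∷ core c5 ∷ core c9 ∷ []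
  core-nb c3 = core c1 ∷ core c4 ∷ start false ∷ []
  core-nb c4 = core c3 ∷ core c7 ∷ core c8 ∷ []
  core-nb c5 = core c2 ∷ core c6 ∷ start true ∷ []
  core-nb c6 = core c5 ∷ core c9 ∷ end false ∷ []
  core-nb c7 = core c0 ∷ core c4 ∷ end true ∷ []
  core-nb c8 = core c1 ∷ core c4 ∷ core c9 ∷ []
  core-nb c9 = core c2 ∷ core c6 ∷ core c8 ∷ []

  prev next : (b : Bool) (i j : ℕ) → i + j ≡ suc n → Vertex
  prev b zero    j p = core (α b)
  prev b (suc i) j p = rail b i (suc j) (trans (ℕ.+-suc i j) p)
  next b i zero    p = core (β b)
  next b i (suc j) p = rail b (suc i) j (trans (sym (ℕ.+-suc i j)) p)

  nb : Vertex → List Vertex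
  nb (core c) = core-nb c
  nb (rail b i j p) = prev b i j p ∷ rail (not b) i j p ∷ next b i j p ∷ []

  open NeighbourLists _≟_ nb
  open import Data.List.Membership.DecPropositional _≟_ using (_∈?_)

  -- Decided by evaluation, uniformly in n: only core vertices and rail ends are compared.
  core-nb-sym : ∀ c → All (λ y → core c ∈ nb y) (nb (core c))
  core-nb-sym = from-yes (Fin.all? λ c → all? (λ y → core c ∈? nb y) (nb (core c)))

  core-nb-unique : ∀ c → Unique (nb (core c))
  core-nb-unique = from-yes (Fin.all? λ c → DecUnique.unique? _≟_ (nb (core c)))

  core-nb-irrefl : ∀ c → core c ∉ nb (core c)
  core-nb-irrefl = from-yes (Fin.all? λ c → ¬? (core c ∈? nb (core c)))

  core-nb-independent : ∀ c → AllPairs (λ y z → z ∉ nb y) (nb (core c))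
  core-nb-independent = from-yes (Fin.all? λ c → allPairs? (λ y z → ¬? (z ∈? nb y)) (nb (core c)))

  end-index : ∀ {i} → i + 0 ≡ suc n → i ≡ suc n
  end-index {i} p = trans (sym (ℕ.+-identityʳ i)) p

  nb-sym : ∀ {x y} → y ∈ nb x → x ∈ nb y
  nb-sym {core c} y∈ = All.lookup (core-nb-sym c) y∈
  nb-sym {rail false zero    j p} (here refl) = there (there (here (rail-≡ refl refl)))
  nb-sym {rail true  zero    j p} (here refl) = there (there (here (rail-≡ refl refl)))
  nb-sym {rail b     (suc i) j p} (here refl) = there (there (here (rail-≡ refl refl)))
  nb-sym {rail b i j p} (there (here refl)) = there (here (rail-≡ (sym (not-involutive b)) refl))
  nb-sym {rail false i zero    p} (there (there (here refl))) = there (there (here (rail-≡ refl (end-index p))))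
  nb-sym {rail true  i zero    p} (there (there (here refl))) = there (there (here (rail-≡ refl (end-index p))))
  nb-sym {rail b     i (suc j) p} (there (there (here refl))) = here (rail-≡ refl refl)

  nb-length : ∀ x → length (nb x) ≡ 3
  nb-length (core c) = from-yes (Fin.all? λ c → length (nb (core c)) ℕ.≟ 3) c
  nb-length (rail _ _ _ _) = refl

  nb-unique : ∀ x → Unique (nb x)
  nb-unique (core c) = core-nb-unique c
  nb-unique (rail b i j p) = (prev≢rung i ∷ prev≢next i j ∷ []) ∷ (rung≢next j ∷ []) ∷ [] ∷ []
    where
    prev≢rung : ∀ i {j p} → prev b i j p ≢ rail (not b) i j p
    prev≢rung zero    ()
    prev≢rung (suc i) = ≢-sym opposite-rails-differ
    rung≢next : ∀ j {i p} → rail (not b) i j p ≢ next b i j p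
    rung≢next zero    ()
    rung≢next (suc j) = opposite-rails-differ
    prev≢next : ∀ i j {p} → prev b i j p ≢ next b i j p
    prev≢next zero    zero    {()}
    prev≢next zero    (suc j) ()
    prev≢next (suc i) zero    ()
    prev≢next (suc i) (suc j) e = ℕ.m≢1+n+m i (proj₂ (rail-injective e))

  rail-colour : Bool → ℕ → Bool
  rail-colour b i = fold b not i

  rail-colour-not : ∀ b i → rail-colour (not b) i ≡ not (rail-colour b i)
  rail-colour-not b zero    = refl
  rail-colour-not b (suc i) = cong not (rail-colour-not b i)

  rail-neighbours-differ : ∀ {b i j p b′ i′ j′ p′} → rail b′ i′ j′ p′ ∈ nb (rail b i j p) →
                           rail-colour b′ i′ ≡ not (rail-colour b i)
  rail-neighbours-differ {i = zero}  (here ())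
  rail-neighbours-differ {i = suc i} (here refl) = sym (not-involutive _)
  rail-neighbours-differ {b} {i} (there (here refl)) = rail-colour-not b i
  rail-neighbours-differ {j = zero}  (there (there (here ())))
  rail-neighbours-differ {j = suc j} (there (there (here refl))) = refl

  nb-irrefl : ∀ x → x ∉ nb x
  nb-irrefl (core c) = core-nb-irrefl c
  nb-irrefl (rail b i j p) x∈ = not-¬ refl (rail-neighbours-differ x∈)

  no-triangle : ∀ {x y z} → y ∈ nb x → z ∈ nb y → x ∈ nb z → ⊥
  no-triangle {core c} = no-core-triangle c
    where
    no-core-triangle : ∀ c {y z} → y ∈ nb (core c) → z ∈ nb y → core c ∈ nb z → ⊥
    no-core-triangle c {y} {z} y∈ z∈ x∈ with ∈-AllPairs₂ (core-nb-independent c) y∈ (nb-sym {z} x∈)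
    ... | inj₁ refl        = nb-irrefl z z∈
    ... | inj₂ (inj₁ z∉)   = z∉ z∈
    ... | inj₂ (inj₂ y∉)   = y∉ (nb-sym z∈)
  no-triangle {rail _ _ _ _} {core _} xy yz zx = no-triangle yz zx xy
  no-triangle {rail _ _ _ _} {rail _ _ _ _} {core _} xy yz zx = no-triangle zx xy yz
  no-triangle {rail b i _ _} {rail b′ i′ _ _} {rail b″ i″ _ _} xy yz zx = not-¬ refl (begin
    rail-colour b i              ≡⟨ rail-neighbours-differ zx ⟩
    not (rail-colour b″ i″)      ≡⟨ cong not (rail-neighbours-differ yz) ⟩
    not (not (rail-colour b′ i′)) ≡⟨ not-involutive _ ⟩
    rail-colour b′ i′            ≡⟨ rail-neighbours-differ xy ⟩
    not (rail-colour b i)        ∎)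
    where open ≡-Reasoning

  rail-square : ∀ b i j p → Square (rail b i j p)
  rail-square b zero    zero    ()
  rail-square b i       (suc j) p = square (there (there (here refl))) (there (here refl)) (here refl)
    (there (here (rail-≡ (sym (not-involutive b)) refl))) opposite-rails-differ opposite-rails-differ
  rail-square b (suc i) zero    p = square (here refl) (there (here refl)) (there (there (here refl)))
    (there (here (rail-≡ (sym (not-involutive b)) refl))) opposite-rails-differ opposite-rails-differ

  record Fingerprint : Set where
    constructor fingerprint
    field
      c0-off-squares      : ¬ Square (core c0)
      core-squares        : ∀ c → c ≡ c0 ⊎ c ≡ c7 ⊎ Square (core c)
      closed-walks-differ : walks 5 (core c0) (core c0) ≢ walks 5 (core c7) (core c7)
      profiles-separate   : ∀ c → Unique (map (profile 5 (core c0)) (nb (core c)))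

  fingerprint? : Dec Fingerprint
  fingerprint? = map′ (λ (a , b , c , d) → fingerprint a b c d) (λ (fingerprint a b c d) → a , b , c , d)
    (¬? (square? (core c0))
      ×-dec Fin.all? (λ c → (c Fin.≟ c0) ⊎-dec (c Fin.≟ c7) ⊎-dec square? (core c))
      ×-dec ¬? (walks 5 (core c0) (core c0) ℕ.≟ walks 5 (core c7) (core c7))
      ×-dec Fin.all? (λ c → DecUnique.unique? (List.≡-dec ℕ._≟_) (map (profile 5 (core c0)) (nb (core c)))))

  module Rigidity (fp : Fingerprint) (aut : Vertex ↔ Vertex) (aut-nb : PreservesAdjacency aut) where

    open Fingerprint fp
    open Automorphism nb-unique aut aut-nb

    ¬square⇒c0⊎c7 : ∀ x → ¬ Square x → x ≡ core c0 ⊎ x ≡ core c7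
    ¬square⇒c0⊎c7 (core c) no-square with core-squares c
    ... | inj₁ refl = inj₁ refl
    ... | inj₂ (inj₁ refl) = inj₂ refl
    ... | inj₂ (inj₂ sq) = ⊥-elim (no-square sq)
    ¬square⇒c0⊎c7 (rail b i j p) no-square = ⊥-elim (no-square (rail-square b i j p))

    c0-fixed : τ (core c0) ≡ core c0
    c0-fixed with ¬square⇒c0⊎c7 (τ (core c0)) (c0-off-squares ∘ square-preimage)
    ... | inj₁ fixed = fixed
    ... | inj₂ c0↦c7 = ⊥-elim (closed-walks-differ (begin
      walks 5 (core c0) (core c0)                ≡⟨ walks-invariant 5 (core c0) (core c0) ⟨
      walks 5 (τ (core c0)) (τ (core c0))        ≡⟨ cong (λ v → walks 5 v v) c0↦c7 ⟩
      walks 5 (core c7) (core c7)                ∎))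
      where open ≡-Reasoning

    fixes-neighbours-of : ∀ c → τ (core c) ≡ core c → ∀ {y} → y ∈ nb (core c) → τ y ≡ y
    fixes-neighbours-of c fixed =
      fixes-separated-neighbours (profile 5 (core c0)) (profile-invariant 5 c0-fixed) fixed (profiles-separate c)

    c1-fixed : τ (core c1) ≡ core c1
    c1-fixed = fixes-neighbours-of c0 c0-fixed (here refl)

    c2-fixed : τ (core c2) ≡ core c2
    c2-fixed = fixes-neighbours-of c0 c0-fixed (there (here refl))

    c3-fixed : τ (core c3) ≡ core c3
    c3-fixed = fixes-neighbours-of c1 c1-fixed (there (here refl))

    c5-fixed : τ (core c5) ≡ core c5
    c5-fixed = fixes-neighbours-of c2 c2-fixed (there (here refl))

    core-fixed : ∀ c → τ (core c) ≡ core c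
    core-fixed c0 = c0-fixed
    core-fixed c1 = c1-fixed
    core-fixed c2 = c2-fixed
    core-fixed c3 = c3-fixed
    core-fixed c4 = fixes-neighbours-of c3 c3-fixed (there (here refl))
    core-fixed c5 = c5-fixed
    core-fixed c6 = fixes-neighbours-of c5 c5-fixed (there (here refl))
    core-fixed c7 = fixes-neighbours-of c0 c0-fixed (there (there (here refl)))
    core-fixed c8 = fixes-neighbours-of c1 c1-fixed (there (there (here refl)))
    core-fixed c9 = fixes-neighbours-of c2 c2-fixed (there (there (here refl)))

    rail-fixed : ∀ b i j p → τ (rail b i j p) ≡ rail b i j p
    prev-fixed : ∀ b i j p → τ (prev b i j p) ≡ prev b i j p

    rail-fixed false zero    j p = fixes-neighbours-of c3 (core-fixed c3) (there (there (here (rail-≡ refl refl))))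
    rail-fixed true  zero    j p = fixes-neighbours-of c5 (core-fixed c5) (there (there (here (rail-≡ refl refl))))
    rail-fixed b     (suc i) j p =
      fixes-last-neighbour (rail-fixed b i (suc j) q) (there (there (here (rail-≡ refl refl)))) others
      where
      q : i + suc j ≡ suc n
      q = trans (ℕ.+-suc i j) p
      others : ∀ {w} → w ∈ nb (rail b i (suc j) q) → w ≢ rail b (suc i) j p → τ w ≡ w
      others (here refl)                 _ = prev-fixed b i (suc j) q
      others (there (here refl))         _ = rail-fixed (not b) i (suc j) q
      others (there (there (here refl))) w≢ = ⊥-elim (w≢ (rail-≡ refl refl))

    prev-fixed b zero    j p = core-fixed (α b)
    prev-fixed b (suc i) j p = rail-fixed b i (suc j) (trans (ℕ.+-suc i j) p)

    rigid : ∀ x → τ x ≡ x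
    rigid (core c) = core-fixed c
    rigid (rail b i j p) = rail-fixed b i j p

  vertex-split : Vertex ↔ (Fin 10 ⊎ (Bool × Fin (2 + n)))
  vertex-split = mk↔ₛ′ to from to∘from from∘to
    where
    to : Vertex → Fin 10 ⊎ (Bool × Fin (2 + n))
    to (core c) = inj₁ c
    to (rail b i j p) = inj₂ (b , fromℕ< (s≤s (subst (i ≤_) p (ℕ.m≤m+n i j))))
    from : Fin 10 ⊎ (Bool × Fin (2 + n)) → Vertex
    from (inj₁ c) = core c
    from (inj₂ (b , k)) = rail b (toℕ k) (suc n ∸ toℕ k) (ℕ.m+[n∸m]≡n (s≤s⁻¹ (Fin.toℕ<n k)))
    to∘from : ∀ v → to (from v) ≡ v
    to∘from (inj₁ c) = refl
    to∘from (inj₂ (b , k)) = cong (λ k → inj₂ (b , k)) (Fin.fromℕ<-toℕ k _)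
    from∘to : ∀ x → from (to x) ≡ x
    from∘to (core c) = refl
    from∘to (rail b i j p) = rail-≡ refl (Fin.toℕ-fromℕ< _)

  -- Opaque, so that ⟦_⟧ stays neutral and the vertices along a walk can be inferred from its type.
  opaque
    numbering : Vertex ↔ Fin (2 * (7 + n))
    numbering = begin
      Vertex                            ↔⟨ vertex-split ⟩
      (Fin 10 ⊎ (Bool × Fin (2 + n)))   ↔⟨ ↔-refl ⊎-↔ (↔-sym Fin.2↔Bool ×-↔ ↔-refl) ⟩
      (Fin 10 ⊎ (Fin 2 × Fin (2 + n)))  ↔⟨ ↔-refl ⊎-↔ ↔-sym Fin.*↔× ⟩
      (Fin 10 ⊎ Fin (2 * (2 + n)))      ↔⟨ ↔-sym Fin.+↔⊎ ⟩
      Fin (10 + 2 * (2 + n))            ≡⟨ cong Fin vertex-count ⟩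
      Fin (2 * (7 + n))                 ∎
      where
      open EquationalReasoning
      vertex-count : 10 + 2 * (2 + n) ≡ 2 * (7 + n)
      vertex-count = trans (cong (10 +_) (ℕ.*-distribˡ-+ 2 2 n)) (sym (ℕ.*-distribˡ-+ 2 7 n))

  open Relabelling numbering nb-sym nb-irrefl public

  core-to-c0 : ∀ c → Walk graph ⟦ core c ⟧ ⟦ core c0 ⟧
  core-to-c0 c0 = here
  core-to-c0 c1 = hop (here refl) here
  core-to-c0 c2 = hop (here refl) here
  core-to-c0 c3 = hop (here refl) (hop (here refl) here)
  core-to-c0 c4 = hop (here refl) (hop (here refl) (hop (here refl) here))
  core-to-c0 c5 = hop (here refl) (hop (here refl) here)
  core-to-c0 c6 = hop (here refl) (hop (here refl) (hop (here refl) here))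
  core-to-c0 c7 = hop (here refl) here
  core-to-c0 c8 = hop (here refl) (hop (here refl) here)
  core-to-c0 c9 = hop (here refl) (hop (here refl) here)

  rail-to-core : ∀ b i j p → Walk graph ⟦ rail b i j p ⟧ ⟦ core (α b) ⟧
  rail-to-core b zero    j p = hop (here refl) here
  rail-to-core b (suc i) j p = hop (here refl) (rail-to-core b i (suc j) (trans (ℕ.+-suc i j) p))

  to-c0 : ∀ x → Walk graph ⟦ x ⟧ ⟦ core c0 ⟧
  to-c0 (core c) = core-to-c0 c
  to-c0 (rail b i j p) = rail-to-core b i j p ◅◅ core-to-c0 (α b)

  pentagon : Walk graph ⟦ core c0 ⟧ ⟦ core c0 ⟧
  pentagon = hop (here refl) (hop (there (here refl)) (hop (there (here refl))
               (hop (there (here refl)) (hop (here refl) here))))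

  graph-properties : Fingerprint →
                     Connected graph × Asymmetric graph × Regular 3 graph × ¬ Bipartite graph × TriangleFree graph
  graph-properties fp = connected (core c0) to-c0 , asymmetric (Rigidity.rigid fp) , regular nb-unique nb-length ,
                  odd-closed-walk⇒¬bipartite pentagon refl , triangle-free no-triangle

-- The decisions look only a few steps into the ladder, so from n = 3 on they evaluate uniformly in m.
fingerprint : ∀ n → Construction.Fingerprint n
fingerprint 0 = from-yes (Construction.fingerprint? 0)
fingerprint 1 = from-yes (Construction.fingerprint? 1)
fingerprint 2 = from-yes (Construction.fingerprint? 2)
fingerprint (suc (suc (suc m))) = from-yes (Construction.fingerprint? (3 + m))

lemma3p3 : (k : ℕ) → 7 ≤ k → Σ (Graph (2 * k)) λ G → Connected G × Asymmetric G × Regular 3 G × ¬ Bipartite G × TriangleFree G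
lemma3p3 k 7≤k with n , refl ← ℕ.m≤n⇒∃[o]m+o≡n 7≤k =
  Construction.graph n , Construction.graph-properties n (fingerprint n)
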